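{- Let $M = (M_{i,j})_{i,j \ge 0}$ be the infinite matrix indexed by natural numbers with $M_{i,j} = 2$ if $j - i = 1$, $M_{i,j} = 1$ if $j - i = 2^q$ for some integer $q \ge 1$, and $M_{i,j} = 0$ otherwise. Let $n \ge 1$. Then setting $y_{i,j} = M_{i,j}$ for $0 \le i < j < n$ gives a feasible solution of the dual linear program: that is, $y_{i,j} \ge 0$ for all $0\le i<j<n$, and for every pair of nonempty sets $R, C \subseteq \{0,1,\dots,n-1\}$ with $\max R < \min C$ we have $\sum_{i \in R,\, j \in C} M_{i,j} \le |R| + |C|$. -}

module Defs where

open import Data.Nat using (ℕ; zero; suc; _+_; _*_; _∸_; _^_; _≤_; _<_; _≡ᵇ_)
open import Data.Bool using (Bool; true; false; if_then_else_; _∨_; _∧_)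
open import Data.Fin using (Fin; toℕ)
open import Data.Fin.Subset using (Subset; _∈_)
open import Data.Fin.Subset.Properties using (_∈?_)
open import Data.Nat.ListAction using (sum)
open import Data.List using (List; map; filter; allFin; cartesianProduct)
open import Data.Vec.Functional using ()
open import Data.Product using (_×_; _,_; ∃-syntax)
open import Relation.Nullary.Decidable using (⌊_⌋)
import Data.Vec as Vec

-- isPow2ge2 d = true  iff  d = 2^q for some q with 1 ≤ q ≤ d
-- (any q with 2^q = d satisfies q < d, so the bound loses nothing).
anyPow : ℕ → ℕ → Bool
anyPow d zero    = false
anyPow d (suc q) = (d ≡ᵇ 2 ^ suc q) ∨ anyPow d q

isPow2≥2 : ℕ → Bool
isPow2≥2 d = anyPow d d

M : ℕ → ℕ → ℕ
M i j with Data.Nat._<ᵇ_ i j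
... | false = 0
... | true  = if (j ∸ i) ≡ᵇ 1 then 2 else (if isPow2≥2 (j ∸ i) then 1 else 0)

elems : ∀ {n} → Subset n → List (Fin n)
elems {n} R = filter (λ i → i ∈? R) (allFin n)

blockSum : ∀ {n} → Subset n → Subset n → ℕ
blockSum R C = sum (map (λ p → M (toℕ (Data.Product.proj₁ p)) (toℕ (Data.Product.proj₂ p)))
                        (cartesianProduct (elems R) (elems C)))

AllBelow : ∀ {n} → Subset n → Subset n → Set
AllBelow {n} R C = ∀ (i j : Fin n) → i ∈ R → j ∈ C → toℕ i < toℕ j

-- Split indices by parity. With P a b = M (2a) (2b), the block sum of M (and likewise of P) over
-- [0, 2n) is a P-block on the even parts of R and C, plus a P-block on their odd parts, plus weighted
-- counts of adjacent pairs (i, i + 1) ∈ R × C. Since max R < min C there is at most one such pair, and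
-- if there is one, both the even and the odd parts are nonempty. Induction on k therefore bounds the
-- P-block over [0, 2^k) by |R| + |C| − 1; one more split, in which an adjacent pair carries weight 2
-- in M, bounds the M-block by |R| + |C|.

module Submission where

open import Defs
open import Data.Bool using (Bool; true; false; T; if_then_else_)
open import Data.Bool.Properties using (T-∨)
open import Data.Empty using (⊥-elim)
open import Data.Fin using (toℕ) renaming (zero to fzero; suc to fsuc)
open import Data.Fin.Subset using (Subset; Nonempty; ∣_∣; _∈_)
open import Data.Fin.Subset.Properties using (_∈?_)
open import Data.List using ([]; _∷_; _++_; map; filter; allFin; tabulate; cartesianProduct)
open import Data.List.Properties using (map-++; map-∘; map-cong; map-tabulate)
open import Data.Nat
open import Data.Nat.ListAction using (sum)
open import Data.Nat.ListAction.Properties using (sum-++)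
open import Data.Nat.Properties
open import Algebra.Properties.CommutativeSemigroup +-commutativeSemigroup using (interchange)
open import Data.Nat.Tactic.RingSolver using (solve-∀)
open import Data.Product using (_×_; _,_; ∃-syntax)
open import Data.Sum using (_⊎_; inj₁; inj₂)
open import Data.Vec using (here; there) renaming ([] to []ᵛ; _∷_ to _∷ᵛ_)
open import Function using (_∘_; id; case_of_; Equivalence)
open import Level using (0ℓ)
open import Relation.Nullary using (¬_; does; yes; no)
open import Relation.Unary using (Pred; Decidable)
open import Relation.Binary.PropositionalEquality


-- Doubling and powers of two

double : ℕ → ℕ
double zero    = zero
double (suc n) = suc (suc (double n))

double≡+ : ∀ n → double n ≡ n + n
double≡+ zero    = refl
double≡+ (suc n) = cong suc (trans (cong suc (double≡+ n)) (sym (+-suc n n)))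

double-injective : ∀ {m n} → double m ≡ double n → m ≡ n
double-injective {zero}  {zero}  _  = refl
double-injective {suc m} {suc n} eq = cong suc (double-injective (suc-injective (suc-injective eq)))

double≢suc-double : ∀ m n → double m ≢ suc (double n)
double≢suc-double (suc m) (suc n) eq = double≢suc-double m n (suc-injective (suc-injective eq))

double-cancel-< : ∀ {m n} → double m < double n → m < n
double-cancel-< {zero}  {suc n} _               = z<s
double-cancel-< {suc m} {suc n} (s<s (s<s m<n)) = s<s (double-cancel-< m<n)

double-≡ᵇ : ∀ m n → (double m ≡ᵇ double n) ≡ (m ≡ᵇ n)
double-≡ᵇ zero    zero    = refl
double-≡ᵇ zero    (suc n) = refl
double-≡ᵇ (suc m) zero    = refl
double-≡ᵇ (suc m) (suc n) = double-≡ᵇ m n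

odd-≡ᵇ-even : ∀ m n → (suc (double m) ≡ᵇ double n) ≡ false
odd-≡ᵇ-even m       zero    = refl
odd-≡ᵇ-even zero    (suc n) = refl
odd-≡ᵇ-even (suc m) (suc n) = odd-≡ᵇ-even m n

2^suc≡double : ∀ k → 2 ^ suc k ≡ double (2 ^ k)
2^suc≡double k = trans (cong (2 ^ k +_) (+-identityʳ (2 ^ k))) (sym (double≡+ (2 ^ k)))

n<2^n : ∀ n → n < 2 ^ n
n<2^n zero    = z<s
n<2^n (suc n) = begin-strict
  suc n         ≡⟨ +-comm 1 n ⟩
  n + 1         <⟨ +-mono-<-≤ (n<2^n n) (m^n>0 2 n) ⟩
  2 ^ n + 2 ^ n ≡⟨ sym (double≡+ (2 ^ n)) ⟩
  double (2 ^ n) ≡⟨ sym (2^suc≡double n) ⟩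
  2 ^ suc n     ∎
  where open ≤-Reasoning

Pow2≥2 : ℕ → Set
Pow2≥2 d = ∃[ k ] d ≡ 2 ^ suc k

anyPow-sound : ∀ d q → T (anyPow d q) → Pow2≥2 d
anyPow-sound d (suc q) t with Equivalence.to T-∨ t
... | inj₁ d≡2^q = q , ≡ᵇ⇒≡ d (2 ^ suc q) d≡2^q
... | inj₂ t′    = anyPow-sound d q t′

anyPow-complete : ∀ d q k → k < q → d ≡ 2 ^ suc k → T (anyPow d q)
anyPow-complete d (suc q) k (s≤s k≤q) d≡2^k with m≤n⇒m<n∨m≡n k≤q
... | inj₁ k<q  = Equivalence.from T-∨ (inj₂ (anyPow-complete d q k k<q d≡2^k))
... | inj₂ refl = Equivalence.from T-∨ (inj₁ (≡⇒≡ᵇ d (2 ^ suc q) d≡2^k))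

isPow2≥2-sound : ∀ d → T (isPow2≥2 d) → Pow2≥2 d
isPow2≥2-sound d = anyPow-sound d d

isPow2≥2-complete : ∀ d → Pow2≥2 d → T (isPow2≥2 d)
isPow2≥2-complete d (k , d≡2^k) =
  anyPow-complete d d k (subst (k <_) (sym d≡2^k) (<-≤-trans (n<2^n k) (m≤m+n (2 ^ k) _))) d≡2^k

T-ext : ∀ {a b} → (T a → T b) → (T b → T a) → a ≡ b
T-ext {false} {false} _ _ = refl
T-ext {false} {true}  _ g = ⊥-elim (g _)
T-ext {true}  {false} f _ = ⊥-elim (f _)
T-ext {true}  {true}  _ _ = refl

¬T⇒≡false : ∀ {b} → ¬ T b → b ≡ false
¬T⇒≡false ¬b = T-ext ¬b (λ ())

Pow2≥2-double⁺ : ∀ {d} → Pow2≥2 d → Pow2≥2 (double d)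
Pow2≥2-double⁺ (k , refl) = suc k , sym (2^suc≡double (suc k))

Pow2≥2-double⁻ : ∀ {d} → Pow2≥2 (double d) → d ≡ 1 ⊎ Pow2≥2 d
Pow2≥2-double⁻ (zero  , eq) = inj₁ (double-injective eq)
Pow2≥2-double⁻ (suc k , eq) = inj₂ (k , double-injective (trans eq (2^suc≡double (suc k))))

¬Pow2≥2-odd : ∀ e → ¬ Pow2≥2 (suc (double e))
¬Pow2≥2-odd e (k , eq) = double≢suc-double (2 ^ k) e (sym (trans eq (2^suc≡double k)))

isPow2≥2-odd : ∀ e → isPow2≥2 (suc (double e)) ≡ false
isPow2≥2-odd e = ¬T⇒≡false (¬Pow2≥2-odd e ∘ isPow2≥2-sound _)

isPow2≥2-double-odd : ∀ e → isPow2≥2 (double (suc (double (suc e)))) ≡ false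
isPow2≥2-double-odd e = ¬T⇒≡false λ t → case Pow2≥2-double⁻ (isPow2≥2-sound _ t) of λ where
    (inj₁ ())
    (inj₂ p) → ¬Pow2≥2-odd (suc e) p

isPow2≥2-double : ∀ e → isPow2≥2 (double (double (suc e))) ≡ isPow2≥2 (double (suc e))
isPow2≥2-double e = T-ext
  (λ t → case Pow2≥2-double⁻ (isPow2≥2-sound _ t) of λ where
    (inj₁ ())
    (inj₂ p) → isPow2≥2-complete (double (suc e)) p)
  (isPow2≥2-complete (double (double (suc e))) ∘ Pow2≥2-double⁺ ∘ isPow2≥2-sound (double (suc e)))


-- The weights at even and odd indices

𝟙 : Bool → ℕ
𝟙 b = if b then 1 else 0

𝟙≤1 : ∀ b → 𝟙 b ≤ 1
𝟙≤1 true  = ≤-refl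
𝟙≤1 false = z≤n

𝟙-positive : ∀ {b} → 0 < 𝟙 b → b ≡ true
𝟙-positive {true} _ = refl

δ : ℕ → ℕ → ℕ
δ a b = 𝟙 (a ≡ᵇ b)

adjacent : ℕ → ℕ → ℕ
adjacent i j = δ (suc i) j

-- For a < b, P a b = 1 exactly when b − a is a power of two, 2⁰ included.
P : ℕ → ℕ → ℕ
P a b = M (double a) (double b)

record ParitySplit (w ee eo oe oo : ℕ → ℕ → ℕ) : Set where
  field
    even-even : ∀ a b → w (double a) (double b) ≡ ee a b
    even-odd  : ∀ a b → w (double a) (suc (double b)) ≡ eo a b
    odd-even  : ∀ a b → w (suc (double a)) (double b) ≡ oe a b
    odd-odd   : ∀ a b → w (suc (double a)) (suc (double b)) ≡ oo a b

M-suc : ∀ i j → M (suc i) (suc j) ≡ M i j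
M-suc i j with i <ᵇ j
... | true  = refl
... | false = refl

M-suc² : ∀ i j → M (suc (suc i)) (suc (suc j)) ≡ M i j
M-suc² i j = trans (M-suc (suc i) (suc j)) (M-suc i j)

M-even-odd : ∀ a b → M (double a) (suc (double b)) ≡ δ a b + δ a b
M-even-odd zero    zero    = refl
M-even-odd zero    (suc b) rewrite isPow2≥2-odd (suc b) = refl
M-even-odd (suc a) zero    = refl
M-even-odd (suc a) (suc b) = trans (M-suc² (double a) (suc (double b))) (M-even-odd a b)

M-odd-even : ∀ a b → M (suc (double a)) (double b) ≡ adjacent a b + adjacent a b
M-odd-even a zero    = refl
M-odd-even a (suc b) = trans (M-suc (double a) (suc (double b))) (M-even-odd a b)

M-split : ParitySplit M P (λ a b → δ a b + δ a b) (λ a b → adjacent a b + adjacent a b) P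
M-split = record
  { even-even = λ _ _ → refl
  ; even-odd  = M-even-odd
  ; odd-even  = M-odd-even
  ; odd-odd   = λ a b → M-suc (double a) (double b)
  }

P-suc : ∀ a b → P (suc a) (suc b) ≡ P a b
P-suc a b = M-suc² (double a) (double b)

P-even-even : ∀ a b → P (double a) (double b) ≡ P a b
P-even-even zero    zero    = refl
P-even-even zero    (suc b) rewrite isPow2≥2-double b = refl
P-even-even (suc a) zero    = refl
P-even-even (suc a) (suc b) =
  trans (P-suc (suc (double a)) (suc (double b)))
    (trans (P-suc (double a) (double b)) (trans (P-even-even a b) (sym (P-suc a b))))

P-even-odd : ∀ a b → P (double a) (suc (double b)) ≡ δ a b
P-even-odd zero    zero    = refl
P-even-odd zero    (suc b) rewrite isPow2≥2-double-odd b = refl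
P-even-odd (suc a) zero    = refl
P-even-odd (suc a) (suc b) =
  trans (P-suc (suc (double a)) (suc (suc (double b)))) (trans (P-suc (double a) (suc (double b))) (P-even-odd a b))

P-odd-even : ∀ a b → P (suc (double a)) (double b) ≡ adjacent a b
P-odd-even a zero    = refl
P-odd-even a (suc b) = trans (P-suc (double a) (suc (double b))) (P-even-odd a b)

P-split : ParitySplit P P δ adjacent P
P-split = record
  { even-even = P-even-even
  ; even-odd  = P-even-odd
  ; odd-even  = P-odd-even
  ; odd-odd   = λ a b → trans (P-suc (double a) (double b)) (P-even-even a b)
  }

adjacent-split : ParitySplit adjacent (λ _ _ → 0) δ adjacent (λ _ _ → 0)
adjacent-split = record
  { even-even = λ a b → cong 𝟙 (odd-≡ᵇ-even a b)
  ; even-odd  = λ a b → cong 𝟙 (double-≡ᵇ a b)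
  ; odd-even  = λ a b → cong 𝟙 (double-≡ᵇ (suc a) b)
  ; odd-odd   = λ a b → cong 𝟙 (odd-≡ᵇ-even a b)
  }


∑< : ℕ → (ℕ → ℕ) → ℕ
∑< zero    f = 0
∑< (suc n) f = f 0 + ∑< n (f ∘ suc)

syntax ∑< n (λ i → e) = ∑[ i < n ] e

∑-cong : ∀ n {f g} → (∀ i → f i ≡ g i) → ∑< n f ≡ ∑< n g
∑-cong zero    f≡g = refl
∑-cong (suc n) f≡g = cong₂ _+_ (f≡g 0) (∑-cong n (f≡g ∘ suc))

∑-zero : ∀ n {f} → (∀ i → f i ≡ 0) → ∑< n f ≡ 0
∑-zero zero    f≡0 = refl
∑-zero (suc n) f≡0 = cong₂ _+_ (f≡0 0) (∑-zero n (f≡0 ∘ suc))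

∑-mono-≤ : ∀ n {f g} → (∀ i → f i ≤ g i) → ∑< n f ≤ ∑< n g
∑-mono-≤ zero    f≤g = z≤n
∑-mono-≤ (suc n) f≤g = +-mono-≤ (f≤g 0) (∑-mono-≤ n (f≤g ∘ suc))

∑-distrib-+ : ∀ n (f g : ℕ → ℕ) → ∑[ i < n ] (f i + g i) ≡ ∑< n f + ∑< n g
∑-distrib-+ zero    f g = refl
∑-distrib-+ (suc n) f g = trans (cong (f 0 + g 0 +_) (∑-distrib-+ n (f ∘ suc) (g ∘ suc)))
                                (interchange (f 0) (g 0) _ _)

∑-double : ∀ n (f : ℕ → ℕ) → ∑[ i < double n ] f i ≡ ∑[ a < n ] f (double a) + ∑[ a < n ] f (suc (double a))
∑-double zero    f = refl
∑-double (suc n) f = begin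
  f 0 + (f 1 + ∑[ i < double n ] f (suc (suc i)))          ≡⟨ cong (λ s → f 0 + (f 1 + s)) (∑-double n (f ∘ suc ∘ suc)) ⟩
  f 0 + (f 1 + (∑< n (f ∘ double ∘ suc) + ∑< n (f ∘ suc ∘ double ∘ suc))) ≡⟨ sym (+-assoc (f 0) (f 1) _) ⟩
  f 0 + f 1 + (∑< n (f ∘ double ∘ suc) + ∑< n (f ∘ suc ∘ double ∘ suc)) ≡⟨ interchange (f 0) (f 1) _ _ ⟩
  (f 0 + ∑< n (f ∘ double ∘ suc)) + (f 1 + ∑< n (f ∘ suc ∘ double ∘ suc)) ∎
  where open ≡-Reasoning

∑-extend : ∀ {m n} {f : ℕ → ℕ} → m ≤ n → (∀ i → m ≤ i → f i ≡ 0) → ∑< m f ≡ ∑< n f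
∑-extend {n = n} z≤n       vanish = sym (∑-zero n (λ i → vanish i z≤n))
∑-extend {f = f} (s≤s m≤n) vanish = cong (f 0 +_) (∑-extend m≤n (λ i → vanish (suc i) ∘ s≤s))

∑-≤1 : ∀ n {f} → (∀ i → f i ≤ 1) → (∀ i j → 0 < f i → 0 < f j → i ≡ j) → ∑< n f ≤ 1
∑-≤1 zero             f≤1 unique = z≤n
∑-≤1 (suc n) {f} f≤1 unique with f 0 ≟ 0
... | yes f0≡0 = begin
  f 0 + ∑< n (f ∘ suc) ≡⟨ cong (_+ ∑< n (f ∘ suc)) f0≡0 ⟩
  ∑< n (f ∘ suc)       ≤⟨ ∑-≤1 n (f≤1 ∘ suc) (λ i j p q → suc-injective (unique (suc i) (suc j) p q)) ⟩
  1                    ∎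
  where open ≤-Reasoning
... | no f0≢0 = begin
  f 0 + ∑< n (f ∘ suc) ≡⟨ cong (f 0 +_) (∑-zero n rest≡0) ⟩
  f 0 + 0              ≡⟨ +-identityʳ (f 0) ⟩
  f 0                  ≤⟨ f≤1 0 ⟩
  1                    ∎
  where
  open ≤-Reasoning
  rest≡0 : ∀ i → f (suc i) ≡ 0
  rest≡0 i = n≤0⇒n≡0 (≮⇒≥ (0≢1+n ∘ unique 0 (suc i) (n≢0⇒n>0 f0≢0)))


-- Block sums over sets of naturals

infixr 5 _◃_
_◃_ : (ℕ → Bool) → (ℕ → ℕ) → ℕ → ℕ
(R ◃ f) i = if R i then f i else 0

evens odds : (ℕ → Bool) → ℕ → Bool
evens R = R ∘ double
odds  R = R ∘ suc ∘ double

size : ℕ → (ℕ → Bool) → ℕ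
size n R = ∑[ i < n ] 𝟙 (R i)

block : ℕ → (ℕ → ℕ → ℕ) → (ℕ → Bool) → (ℕ → Bool) → ℕ
block n w R C = ∑[ i < n ] (R ◃ λ i → ∑[ j < n ] (C ◃ w i) j) i

Below : (ℕ → Bool) → (ℕ → Bool) → Set
Below R C = ∀ i j → R i ≡ true → C j ≡ true → i < j

VanishesFrom : ℕ → (ℕ → Bool) → Set
VanishesFrom m R = ∀ i → m ≤ i → R i ≡ false

◃-cong : ∀ R {f g} → (∀ i → f i ≡ g i) → ∀ i → (R ◃ f) i ≡ (R ◃ g) i
◃-cong R f≡g i = cong (if R i then_else 0) (f≡g i)

◃-zero : ∀ R i → (R ◃ λ _ → 0) i ≡ 0
◃-zero R i with R i
... | true  = refl
... | false = refl

◃-vanish : ∀ R f i → R i ≡ false → (R ◃ f) i ≡ 0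
◃-vanish R f i Ri = cong (if_then f i else 0) Ri

◃-distrib-+ : ∀ R f g i → (R ◃ λ i → f i + g i) i ≡ (R ◃ f) i + (R ◃ g) i
◃-distrib-+ R f g i with R i
... | true  = refl
... | false = refl

◃-mono-≤ : ∀ R {f g} → (∀ i → f i ≤ g i) → ∀ i → (R ◃ f) i ≤ (R ◃ g) i
◃-mono-≤ R f≤g i with R i
... | true  = f≤g i
... | false = z≤n

◃-≤ : ∀ R f i → (R ◃ f) i ≤ f i
◃-≤ R f i with R i
... | true  = ≤-refl
... | false = z≤n

◃-positive : ∀ R f i → 0 < (R ◃ f) i → R i ≡ true × 0 < f i
◃-positive R f i pos with R i
... | true = refl , pos

∑◃-cong : ∀ n R {f g} → (∀ i → f i ≡ g i) → ∑[ i < n ] (R ◃ f) i ≡ ∑[ i < n ] (R ◃ g) i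
∑◃-cong n R f≡g = ∑-cong n (◃-cong R f≡g)

∑◃-distrib-+ : ∀ n R f g → ∑[ i < n ] (R ◃ λ i → f i + g i) i ≡ ∑[ i < n ] (R ◃ f) i + ∑[ i < n ] (R ◃ g) i
∑◃-distrib-+ n R f g = trans (∑-cong n (◃-distrib-+ R f g)) (∑-distrib-+ n (R ◃ f) (R ◃ g))

∑◃-empty : ∀ n R f → size n R ≡ 0 → ∑[ i < n ] (R ◃ f) i ≡ 0
∑◃-empty zero    R f _ = refl
∑◃-empty (suc n) R f empty with R 0
... | false = ∑◃-empty n (R ∘ suc) (f ∘ suc) empty

∑◃-δ : ∀ n C k → ∑[ j < n ] (C ◃ δ k) j ≤ 𝟙 (C k)
∑◃-δ zero    C k       = z≤n
∑◃-δ (suc n) C zero    = ≤-reflexive (trans (cong (𝟙 (C 0) +_) (∑-zero n (◃-zero (C ∘ suc)))) (+-identityʳ _))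
∑◃-δ (suc n) C (suc k) =
  ≤-trans (≤-reflexive (cong (_+ ∑[ j < n ] ((C ∘ suc) ◃ δ k) j) (◃-zero C 0))) (∑◃-δ n (C ∘ suc) k)

block-distrib-+ : ∀ n w w′ R C → block n (λ i j → w i j + w′ i j) R C ≡ block n w R C + block n w′ R C
block-distrib-+ n w w′ R C =
  trans (∑◃-cong n R (λ i → ∑◃-distrib-+ n C (w i) (w′ i))) (∑◃-distrib-+ n R _ _)

block-zero : ∀ n R C → block n (λ _ _ → 0) R C ≡ 0
block-zero n R C = ∑-zero n (λ i → trans (◃-cong R (λ i → ∑-zero n (◃-zero C)) i) (◃-zero R i))

block-emptyˡ : ∀ n w R C → size n R ≡ 0 → block n w R C ≡ 0
block-emptyˡ n w R C = ∑◃-empty n R _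

block-emptyʳ : ∀ n w R C → size n C ≡ 0 → block n w R C ≡ 0
block-emptyʳ n w R C empty =
  ∑-zero n (λ i → trans (◃-cong R (λ i → ∑◃-empty n C (w i) empty) i) (◃-zero R i))

size-double : ∀ n R → size (double n) R ≡ size n (evens R) + size n (odds R)
size-double n R = ∑-double n (𝟙 ∘ R)

size-extend : ∀ {m n R} → m ≤ n → VanishesFrom m R → size m R ≡ size n R
size-extend m≤n R≥m = ∑-extend m≤n (λ i m≤i → cong 𝟙 (R≥m i m≤i))

block-extend : ∀ {m n} w {R C} → m ≤ n → VanishesFrom m R → VanishesFrom m C → block m w R C ≡ block n w R C
block-extend {m} {n} w {R} {C} m≤n R≥m C≥m =
  trans (∑◃-cong m R (λ i → ∑-extend m≤n (λ j m≤j → ◃-vanish C (w i) j (C≥m j m≤j))))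
        (∑-extend m≤n (λ i m≤i → ◃-vanish R (λ i → ∑[ j < n ] (C ◃ w i) j) i (R≥m i m≤i)))

module _ {w ee eo oe oo} (split : ParitySplit w ee eo oe oo) where
  open ParitySplit split

  block-double : ∀ n R C → block (double n) w R C ≡
    (block n ee (evens R) (evens C) + block n eo (evens R) (odds C)) +
    (block n oe (odds R) (evens C) + block n oo (odds R) (odds C))
  block-double n R C = begin
    block (double n) w R C
      ≡⟨ ∑-double n _ ⟩
    ∑[ a < n ] (evens R ◃ row ∘ double) a + ∑[ a < n ] (odds R ◃ row ∘ suc ∘ double) a
      ≡⟨ cong₂ _+_ (∑◃-cong n (evens R) (row-double double even-even even-odd))
                   (∑◃-cong n (odds R) (row-double (suc ∘ double) odd-even odd-odd)) ⟩
    ∑[ a < n ] (evens R ◃ λ a → ∑< n (evens C ◃ ee a) + ∑< n (odds C ◃ eo a)) a +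
    ∑[ a < n ] (odds R ◃ λ a → ∑< n (evens C ◃ oe a) + ∑< n (odds C ◃ oo a)) a
      ≡⟨ cong₂ _+_ (∑◃-distrib-+ n (evens R) _ _) (∑◃-distrib-+ n (odds R) _ _) ⟩
    (block n ee (evens R) (evens C) + block n eo (evens R) (odds C)) +
    (block n oe (odds R) (evens C) + block n oo (odds R) (odds C)) ∎
    where
    open ≡-Reasoning
    row : ℕ → ℕ
    row i = ∑[ j < double n ] (C ◃ w i) j
    row-double : ∀ (h : ℕ → ℕ) {e o : ℕ → ℕ → ℕ} →
      (∀ a b → w (h a) (double b) ≡ e a b) → (∀ a b → w (h a) (suc (double b)) ≡ o a b) →
      ∀ a → row (h a) ≡ ∑< n (evens C ◃ e a) + ∑< n (odds C ◃ o a)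
    row-double h w≡e w≡o a =
      trans (∑-double n (C ◃ w (h a))) (cong₂ _+_ (∑◃-cong n (evens C) (w≡e a)) (∑◃-cong n (odds C) (w≡o a)))

Below-evens : ∀ {R C} → Below R C → Below (evens R) (evens C)
Below-evens R<C i j Ri Cj = double-cancel-< (R<C _ _ Ri Cj)

Below-odds : ∀ {R C} → Below R C → Below (odds R) (odds C)
Below-odds R<C i j Ri Cj = double-cancel-< (s<s⁻¹ (R<C _ _ Ri Cj))


-- Adjacent pairs

block-adjacent≤1 : ∀ n {R C} → Below R C → block n adjacent R C ≤ 1
block-adjacent≤1 n {R} {C} R<C = begin
  block n adjacent R C                 ≤⟨ ∑-mono-≤ n (◃-mono-≤ R (λ i → ∑◃-δ n C (suc i))) ⟩
  ∑[ i < n ] (R ◃ 𝟙 ∘ C ∘ suc) i ≤⟨ ∑-≤1 n (λ i → ≤-trans (◃-≤ R (𝟙 ∘ C ∘ suc) i) (𝟙≤1 (C (suc i)))) unique ⟩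
  1                                    ∎
  where
  open ≤-Reasoning
  member : ∀ i → 0 < (R ◃ 𝟙 ∘ C ∘ suc) i → R i ≡ true × C (suc i) ≡ true
  member i pos with ◃-positive R (𝟙 ∘ C ∘ suc) i pos
  ... | Ri , Ci₊ = Ri , 𝟙-positive Ci₊
  unique : ∀ i j → 0 < (R ◃ 𝟙 ∘ C ∘ suc) i → 0 < (R ◃ 𝟙 ∘ C ∘ suc) j → i ≡ j
  unique i j pi pj with member i pi | member j pj
  ... | Ri , Ci₊ | Rj , Cj₊ = ≤-antisym (s≤s⁻¹ (R<C i (suc j) Ri Cj₊)) (s≤s⁻¹ (R<C j (suc i) Rj Ci₊))

cross : ℕ → (ℕ → Bool) → (ℕ → Bool) → ℕ
cross n R C = block n δ (evens R) (odds C) + block n adjacent (odds R) (evens C)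

block-adjacent-double : ∀ n R C → block (double n) adjacent R C ≡ cross n R C
block-adjacent-double n R C = begin
  block (double n) adjacent R C
    ≡⟨ block-double adjacent-split n R C ⟩
  (block n (λ _ _ → 0) (evens R) (evens C) + X) + (Y + block n (λ _ _ → 0) (odds R) (odds C))
    ≡⟨ cong₂ (λ a b → (a + X) + (Y + b)) (block-zero n _ _) (block-zero n _ _) ⟩
  X + (Y + 0)
    ≡⟨ cong (X +_) (+-identityʳ Y) ⟩
  X + Y ∎
  where
  open ≡-Reasoning
  X = block n δ (evens R) (odds C)
  Y = block n adjacent (odds R) (evens C)

cross≤1 : ∀ n {R C} → Below R C → cross n R C ≤ 1
cross≤1 n {R} {C} R<C = subst (_≤ 1) (block-adjacent-double n R C) (block-adjacent≤1 (double n) R<C)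

cross-evens-empty : ∀ n R C → size n (evens R) + size n (evens C) ≡ 0 → cross n R C ≡ 0
cross-evens-empty n R C empty =
  cong₂ _+_ (block-emptyˡ n δ (evens R) (odds C) (m+n≡0⇒m≡0 _ empty))
            (block-emptyʳ n adjacent (odds R) (evens C) (m+n≡0⇒n≡0 _ empty))

cross-odds-empty : ∀ n R C → size n (odds R) + size n (odds C) ≡ 0 → cross n R C ≡ 0
cross-odds-empty n R C empty =
  cong₂ _+_ (block-emptyʳ n δ (evens R) (odds C) (m+n≡0⇒n≡0 _ empty))
            (block-emptyˡ n adjacent (odds R) (evens C) (m+n≡0⇒m≡0 _ empty))


-- Induction on doublings

+∸1-absorb : ∀ n {c} → c ≤ 1 → (n ≡ 0 → c ≡ 0) → c + (n ∸ 1) ≤ n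
+∸1-absorb zero    c≤1 c≡0 = ≤-reflexive (trans (+-identityʳ _) (c≡0 refl))
+∸1-absorb (suc n) c≤1 _   = +-monoˡ-≤ n c≤1

halves-∸1-bound : ∀ E O {gE gO c} → gE ≤ E ∸ 1 → gO ≤ O ∸ 1 → c ≤ 1 →
  (E ≡ 0 → c ≡ 0) → (O ≡ 0 → c ≡ 0) → gE + gO + c ≤ (E + O) ∸ 1
halves-∸1-bound zero O {gE} {gO} {c} gE≤ gO≤ _ c≡0 _ = begin
  gE + gO + c ≡⟨ cong₂ (λ a b → a + gO + b) (n≤0⇒n≡0 gE≤) (c≡0 refl) ⟩
  gO + 0      ≡⟨ +-identityʳ gO ⟩
  gO          ≤⟨ gO≤ ⟩
  O ∸ 1       ∎
  where open ≤-Reasoning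
halves-∸1-bound (suc e) O {gE} {gO} {c} gE≤ gO≤ c≤1 _ c≡0 = begin
  gE + gO + c       ≡⟨ +-assoc gE gO c ⟩
  gE + (gO + c)     ≡⟨ cong (gE +_) (+-comm gO c) ⟩
  gE + (c + gO)     ≤⟨ +-mono-≤ gE≤ (+-monoʳ-≤ c gO≤) ⟩
  e + (c + (O ∸ 1)) ≤⟨ +-monoʳ-≤ e (+∸1-absorb O c≤1 c≡0) ⟩
  e + O             ∎
  where open ≤-Reasoning

halves-bound : ∀ E O {gE gO c} → gE ≤ E ∸ 1 → gO ≤ O ∸ 1 → c ≤ 1 →
  (E ≡ 0 → c ≡ 0) → (O ≡ 0 → c ≡ 0) → gE + gO + (c + c) ≤ E + O
halves-bound E O {gE} {gO} {c} gE≤ gO≤ c≤1 cE≡0 cO≡0 = begin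
  gE + gO + (c + c)             ≡⟨ rearrange gE gO c ⟩
  (c + gE) + (c + gO)           ≤⟨ +-mono-≤ (+-monoʳ-≤ c gE≤) (+-monoʳ-≤ c gO≤) ⟩
  (c + (E ∸ 1)) + (c + (O ∸ 1)) ≤⟨ +-mono-≤ (+∸1-absorb E c≤1 cE≡0) (+∸1-absorb O c≤1 cO≡0) ⟩
  E + O                         ∎
  where
  open ≤-Reasoning
  rearrange : ∀ a b c → a + b + (c + c) ≡ (c + a) + (c + b)
  rearrange = solve-∀

PBound : ℕ → Set
PBound n = ∀ R C → Below R C → block n P R C ≤ (size n R + size n C) ∸ 1

PBound-1 : PBound 1
PBound-1 R C _ with R 0 | C 0
... | true  | true  = z≤n
... | true  | false = z≤n
... | false | _     = z≤n

module _ (n : ℕ) (R C : ℕ → Bool) where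
  private
    E O gE gO : ℕ
    E  = size n (evens R) + size n (evens C)
    O  = size n (odds R) + size n (odds C)
    gE = block n P (evens R) (evens C)
    gO = block n P (odds R) (odds C)

  size-double-+ : size (double n) R + size (double n) C ≡ E + O
  size-double-+ = trans (cong₂ _+_ (size-double n R) (size-double n C))
    (interchange (size n (evens R)) (size n (odds R)) (size n (evens C)) (size n (odds C)))

  block-P-double : block (double n) P R C ≡ gE + gO + cross n R C
  block-P-double = trans (block-double P-split n R C) (rearrange gE gO _ _)
    where
    rearrange : ∀ a b x y → (a + x) + (y + b) ≡ a + b + (x + y)
    rearrange = solve-∀

  block-M-double : block (double n) M R C ≡ gE + gO + (cross n R C + cross n R C)
  block-M-double = begin
    block (double n) M R C
      ≡⟨ block-double M-split n R C ⟩
    (gE + block n (λ a b → δ a b + δ a b) (evens R) (odds C)) + (block n (λ a b → adjacent a b + adjacent a b) (odds R) (evens C) + gO)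
      ≡⟨ cong₂ (λ x y → (gE + x) + (y + gO)) (block-distrib-+ n δ δ _ _) (block-distrib-+ n adjacent adjacent _ _) ⟩
    (gE + (x + x)) + ((y + y) + gO)
      ≡⟨ rearrange gE gO x y ⟩
    gE + gO + (cross n R C + cross n R C) ∎
    where
    open ≡-Reasoning
    x = block n δ (evens R) (odds C)
    y = block n adjacent (odds R) (evens C)
    rearrange : ∀ a b x y → (a + (x + x)) + ((y + y) + b) ≡ a + b + ((x + y) + (x + y))
    rearrange = solve-∀

PBound-double : ∀ n → PBound n → PBound (double n)
PBound-double n bound R C R<C = begin
  block (double n) P R C ≡⟨ block-P-double n R C ⟩
  _                      ≤⟨ halves-∸1-bound _ _ (bound _ _ (Below-evens R<C)) (bound _ _ (Below-odds R<C))
                              (cross≤1 n R<C) (cross-evens-empty n R C) (cross-odds-empty n R C) ⟩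
  _                      ≡⟨ cong (_∸ 1) (sym (size-double-+ n R C)) ⟩
  (size (double n) R + size (double n) C) ∸ 1 ∎
  where open ≤-Reasoning

PBound-2^ : ∀ k → PBound (2 ^ k)
PBound-2^ zero    = PBound-1
PBound-2^ (suc k) = subst PBound (sym (2^suc≡double k)) (PBound-double (2 ^ k) (PBound-2^ k))

M-bound : ∀ n → PBound n → ∀ R C → Below R C → block (double n) M R C ≤ size (double n) R + size (double n) C
M-bound n bound R C R<C = begin
  block (double n) M R C ≡⟨ block-M-double n R C ⟩
  _                      ≤⟨ halves-bound _ _ (bound _ _ (Below-evens R<C)) (bound _ _ (Below-odds R<C))
                              (cross≤1 n R<C) (cross-evens-empty n R C) (cross-odds-empty n R C) ⟩
  _                      ≡⟨ sym (size-double-+ n R C) ⟩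
  size (double n) R + size (double n) C ∎
  where open ≤-Reasoning


-- Subsets of Fin n

sum-cartesianProduct : ∀ {A B : Set} (f : A × B → ℕ) xs ys →
  sum (map f (cartesianProduct xs ys)) ≡ sum (map (λ x → sum (map (λ y → f (x , y)) ys)) xs)
sum-cartesianProduct f []       ys = refl
sum-cartesianProduct f (x ∷ xs) ys = begin
  sum (map f (map (x ,_) ys ++ cartesianProduct xs ys))
    ≡⟨ cong sum (map-++ f (map (x ,_) ys) _) ⟩
  sum (map f (map (x ,_) ys) ++ map f (cartesianProduct xs ys))
    ≡⟨ sum-++ (map f (map (x ,_) ys)) _ ⟩
  sum (map f (map (x ,_) ys)) + sum (map f (cartesianProduct xs ys))
    ≡⟨ cong₂ _+_ (cong sum (sym (map-∘ ys))) (sum-cartesianProduct f xs ys) ⟩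
  sum (map (λ y → f (x , y)) ys) + sum (map (λ x → sum (map (λ y → f (x , y)) ys)) xs) ∎
  where open ≡-Reasoning

sum-map-filter : ∀ {A : Set} {Q : Pred A 0ℓ} (Q? : Decidable Q) (f : A → ℕ) xs →
  sum (map f (filter Q? xs)) ≡ sum (map (λ x → if does (Q? x) then f x else 0) xs)
sum-map-filter Q? f []       = refl
sum-map-filter Q? f (x ∷ xs) with does (Q? x)
... | true  = cong (f x +_) (sum-map-filter Q? f xs)
... | false = sum-map-filter Q? f xs

sum-tabulate : ∀ n (f : ℕ → ℕ) → sum (tabulate {n = n} (f ∘ toℕ)) ≡ ∑< n f
sum-tabulate zero    f = refl
sum-tabulate (suc n) f = cong (f 0 +_) (sum-tabulate n (f ∘ suc))

χ : ∀ {n} → Subset n → ℕ → Bool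
χ []ᵛ      _       = false
χ (b ∷ᵛ R) zero    = b
χ (b ∷ᵛ R) (suc i) = χ R i

χ-toℕ : ∀ {n} (R : Subset n) x → χ R (toℕ x) ≡ does (x ∈? R)
χ-toℕ (true  ∷ᵛ R) fzero    = refl
χ-toℕ (false ∷ᵛ R) fzero    = refl
χ-toℕ (b     ∷ᵛ R) (fsuc x) = χ-toℕ R x

χ-vanishes : ∀ {n} (R : Subset n) → VanishesFrom n (χ R)
χ-vanishes []ᵛ      i       _         = refl
χ-vanishes (b ∷ᵛ R) (suc i) (s≤s n≤i) = χ-vanishes R i n≤i

χ-member : ∀ {n} (R : Subset n) i → χ R i ≡ true → ∃[ x ] toℕ x ≡ i × x ∈ R
χ-member (true ∷ᵛ R) zero    refl = fzero , refl , here
χ-member (b    ∷ᵛ R) (suc i) Ri   with χ-member R i Ri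
... | x , refl , x∈R = fsuc x , refl , there x∈R

AllBelow⇒Below : ∀ {n} {R C : Subset n} → AllBelow R C → Below (χ R) (χ C)
AllBelow⇒Below {R = R} {C} R<C i j Ri Cj with χ-member R i Ri | χ-member C j Cj
... | x , refl , x∈R | y , refl , y∈C = R<C x y x∈R y∈C

sum-elems : ∀ {n} (R : Subset n) (f : ℕ → ℕ) → sum (map (f ∘ toℕ) (elems R)) ≡ ∑[ i < n ] (χ R ◃ f) i
sum-elems {n} R f = begin
  sum (map (f ∘ toℕ) (elems R))
    ≡⟨ sum-map-filter (_∈? R) (f ∘ toℕ) (allFin n) ⟩
  sum (map (λ x → if does (x ∈? R) then f (toℕ x) else 0) (allFin n))
    ≡⟨ cong sum (map-cong (λ x → cong (if_then f (toℕ x) else 0) (sym (χ-toℕ R x))) (allFin n)) ⟩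
  sum (map ((χ R ◃ f) ∘ toℕ) (allFin n))
    ≡⟨ cong sum (map-tabulate {n = n} id ((χ R ◃ f) ∘ toℕ)) ⟩
  sum (tabulate {n = n} ((χ R ◃ f) ∘ toℕ))
    ≡⟨ sum-tabulate n (χ R ◃ f) ⟩
  ∑[ i < n ] (χ R ◃ f) i ∎
  where open ≡-Reasoning

∣∣≡size : ∀ {n} (R : Subset n) → ∣ R ∣ ≡ size n (χ R)
∣∣≡size []ᵛ          = refl
∣∣≡size (true  ∷ᵛ R) = cong suc (∣∣≡size R)
∣∣≡size (false ∷ᵛ R) = ∣∣≡size R

blockSum≡block : ∀ {n} (R C : Subset n) → blockSum R C ≡ block n M (χ R) (χ C)
blockSum≡block {n} R C = begin
  blockSum R C
    ≡⟨ sum-cartesianProduct _ (elems R) (elems C) ⟩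
  sum (map (λ x → sum (map (M (toℕ x) ∘ toℕ) (elems C))) (elems R))
    ≡⟨ cong sum (map-cong (λ x → sum-elems C (M (toℕ x))) (elems R)) ⟩
  sum (map (λ x → ∑[ j < n ] (χ C ◃ M (toℕ x)) j) (elems R))
    ≡⟨ sum-elems R (λ i → ∑[ j < n ] (χ C ◃ M i) j) ⟩
  block n M (χ R) (χ C) ∎
  where open ≡-Reasoning

lemma7 : (n : ℕ) → 1 ≤ n →
    ((i j : ℕ) → i < j → j < n → 0 ≤ M i j) ×
    ((R C : Subset n) → Nonempty R → Nonempty C → AllBelow R C →
      blockSum R C ≤ ∣ R ∣ + ∣ C ∣)
lemma7 n _ = (λ _ _ _ _ → z≤n) , λ R C _ _ R<C → begin
  blockSum R C                ≡⟨ blockSum≡block R C ⟩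
  block n M (χ R) (χ C)       ≡⟨ block-extend M n≤N (χ-vanishes R) (χ-vanishes C) ⟩
  block N M (χ R) (χ C)       ≤⟨ M-bound (2 ^ n) (PBound-2^ n) (χ R) (χ C) (AllBelow⇒Below R<C) ⟩
  size N (χ R) + size N (χ C) ≡⟨ sym (cong₂ _+_ (size-extend n≤N (χ-vanishes R)) (size-extend n≤N (χ-vanishes C))) ⟩
  size n (χ R) + size n (χ C) ≡⟨ sym (cong₂ _+_ (∣∣≡size R) (∣∣≡size C)) ⟩
  ∣ R ∣ + ∣ C ∣               ∎
  where
  open ≤-Reasoning
  N : ℕ
  N = double (2 ^ n)
  n≤N : n ≤ N
  n≤N = ≤-trans (<⇒≤ (n<2^n n)) (≤-trans (m≤m+n (2 ^ n) (2 ^ n)) (≤-reflexive (sym (double≡+ (2 ^ n)))))
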